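{- Let $\iota_n=12\cdots n$ and, for a set $B\subseteq S_3$, let $e_B(n)$ denote the number of permutations in $S_n$ equivalent to $\iota_n$ under doubly adjacent $B$-equivalence. Then for all $n\ge1$: (i) $e_{\{123,132\}}(n)=a(n)$ where $a(1)=a(2)=1$ and $a(n)=a(n-1)+a(n-2)$ (Fibonacci numbers $F(n)$); (ii) $e_{\{123,321\}}(n)=a(n)$ where $a(0)=a(1)=a(2)=1$ and $a(n)=a(n-1)+a(n-3)$; (iii) $e_{\{123,132,213\}}(n)=F(n+1)-[n\text{ is even}]$, where $F$ is as in (i); (iv) $e_{\{123,132,321\}}(n)=a(n)$ where $a(0)=a(1)=a(2)=1$ and $a(n)=a(n-1)+a(n-2)+a(n-3)$; (v) $e_{\{123,132,213,321\}}(n)=T(n+2)-[n\text{ is even}]$, where $T(0)=T(1)=0$, $T(2)=1$ and $T(n)=T(n-1)+T(n-2)+T(n-3)$.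
   Context: Permutations are written as words $\pi_1\cdots\pi_n$. A sequence of distinct integers $a_1a_2a_3$ has pattern $\sigma\in S_3$ if $a_s<a_t\iff\sigma_s<\sigma_t$. For $B\subseteq S_3$, a doubly adjacent move on $\pi\in S_n$ chooses three consecutive positions $i,i+1,i+2$ such that $\{\pi_i,\pi_{i+1},\pi_{i+2}\}$ is a set of three consecutive integers and $\pi_i\pi_{i+1}\pi_{i+2}$ has pattern $\sigma\in B$, and rearranges these three values in these positions to have a pattern $\sigma'\in B$. Doubly adjacent $B$-equivalence is the equivalence relation generated by such moves. $[S]$ denotes the Iverson bracket: $1$ if statement $S$ is true and $0$ otherwise. -}

module Defs where

open import Data.Nat using (ℕ; zero; suc; _+_; _∸_)
open import Data.Bool using (if_then_else_)
open import Data.Nat using (_%_; _≡ᵇ_)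
open import Data.List using (List; []; _∷_; _++_; map; upTo; length)
open import Data.List.Membership.Propositional using (_∈_)
open import Data.List.Relation.Unary.Unique.Propositional using (Unique)
open import Data.Product using (Σ; ∃; _×_; _,_)
open import Function.Bundles using (_⇔_)
open import Relation.Binary.PropositionalEquality using (_≡_)
open import Relation.Binary.Construct.Closure.Equivalence using (EqClosure)

-- A permutation is a word (list of values); S_n consists of permutations of 1..n.
-- A pattern σ ∈ S_3 is a word over {1,2,3}, e.g. 1 ∷ 3 ∷ 2 ∷ [] is 132.
Word : Set
Word = List ℕ

-- the three consecutive values m+1, m+2, m+3 arranged in pattern σ
place : ℕ → Word → Word
place m σ = map (m +_) σ

data Move (B : List Word) : Word → Word → Set where
  move : (pre suf : Word) (m : ℕ) (σ σ' : Word) → σ ∈ B → σ' ∈ B →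
         Move B (pre ++ place m σ ++ suf) (pre ++ place m σ' ++ suf)

DAEquiv : List Word → Word → Word → Set
DAEquiv B = EqClosure (Move B)

ι : ℕ → Word
ι n = map suc (upTo n)

-- e_B(n) = k : the class of ι_n is enumerated without repetition by a list of length k
IsClassSize : List Word → ℕ → ℕ → Set
IsClassSize B n k =
  Σ (List Word) λ L → Unique L × (∀ π → (π ∈ L) ⇔ DAEquiv B π (ι n)) × length L ≡ k

p123 p132 p213 p321 : Word
p123 = 1 ∷ 2 ∷ 3 ∷ []
p132 = 1 ∷ 3 ∷ 2 ∷ []
p213 = 2 ∷ 1 ∷ 3 ∷ []
p321 = 3 ∷ 2 ∷ 1 ∷ []

evenInd : ℕ → ℕ
evenInd n = if (n % 2) ≡ᵇ 0 then 1 else 0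

F : ℕ → ℕ
F 0 = 0
F 1 = 1
F (suc (suc n)) = F (suc n) + F n

A2 : ℕ → ℕ
A2 0 = 1
A2 1 = 1
A2 2 = 1
A2 (suc (suc (suc n))) = A2 (suc (suc n)) + A2 n

A4 : ℕ → ℕ
A4 0 = 1
A4 1 = 1
A4 2 = 1
A4 (suc (suc (suc n))) = A4 (suc (suc n)) + A4 (suc n) + A4 n

T : ℕ → ℕ
T 0 = 0
T 1 = 0
T 2 = 1
T (suc (suc (suc n))) = T (suc (suc n)) + T (suc n) + T n

module Submission where

-- A *tiling* is a composition into parts 1, 2, 3 (a list of tiles).
-- A tiling is rendered as the permutation built from consecutive blocks, each a
-- decreasing run of consecutive values, the blocks increasing from left to right:
-- above the value k a tile of width w is the block  k+w, ..., k+1.  The identity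
-- ι_n is the rendering of the tiling 1ⁿ, and every pattern of S₃ is itself the
-- rendering of a tiling of 3 (123 = 1·1·1, 132 = 1·2, 213 = 2·1, 321 = 3).
-- The key fact is that an occurrence of a pattern in a rendered permutation
-- always covers whole tiles (decompose).  Hence doubly adjacent B-moves on
-- rendered permutations are exactly the tile rewrites  a·τ(σ)·b ↔ a·τ(σ')·b
-- (rewrite⇒move, move⇒rewrite).  So if a Boolean predicate V on tilings is
-- invariant under the rewrites, holds at 1ⁿ, and every V-tiling rewrites to 1ⁿ,
-- then the class of ι_n consists exactly of the renderings of the V-tilings of n
-- (class-size).  For each of the five sets B we exhibit such a V and count the
-- V-tilings of n by the three-term recurrence for tilings (count-comps).

open import Defs
open import Data.Nat using (ℕ; zero; suc; _+_; _∸_; _<_; _≤_; s≤s)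
open import Data.Nat.ListAction using (sum)
open import Data.Nat.Properties
  using (m≤n+m; m+n≮n; <-trans; n<1+n; +-comm; +-suc; +-assoc; +-identityʳ; m+n∸n≡m)
open import Data.Nat.Tactic.RingSolver using (solve-∀)
open import Data.Bool using (Bool; true; false; not; _∧_; _∨_; T?) renaming (T to True)
open import Data.Bool.Properties using (T-∧; ∧-identityʳ)
open import Data.Bool.ListAction using (all; any)
open import Data.List using (List; []; _∷_; _++_; map; replicate; applyUpTo; filterᵇ; length)
open import Data.List.Properties
  using (∷-injectiveˡ; ∷-injectiveʳ; ++-assoc; ++-identityʳ; map-cong; map-upTo;
         filter-++; length-++; length-map)
open import Data.List.Relation.Unary.All using (All; []; _∷_; lookup)
import Data.List.Relation.Unary.All as All
import Data.List.Relation.Unary.All.Properties as All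
open import Data.List.Relation.Unary.Any using (here; there)
open import Data.List.Membership.Propositional using (_∈_)
open import Data.List.Membership.Propositional.Properties
  using (∈-map⁺; ∈-map⁻; ∈-++⁺ˡ; ∈-++⁺ʳ; ∈-++⁻; ∈-filter⁺; ∈-filter⁻)
open import Data.List.Relation.Unary.Unique.Propositional using (Unique; []; _∷_)
import Data.List.Relation.Unary.Unique.Propositional.Properties as Unique
open import Data.Product using (∃; ∃₂; _×_; _,_)
open import Data.Sum using (inj₁; inj₂)
open import Data.Empty using (⊥; ⊥-elim)
open import Function using (_∘_; _⇔_; mk⇔; Equivalence)
open import Function.Properties.Equivalence using (⇔-isEquivalence)
import Relation.Binary.Construct.On as On
open import Relation.Binary.PropositionalEquality
  using (_≡_; refl; sym; trans; cong; cong₂; subst; subst₂; module ≡-Reasoning)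
open import Relation.Binary.Construct.Closure.Equivalence using (EqClosure; gmap; fold)
open import Relation.Binary.Construct.Closure.ReflexiveTransitive using (ε; _◅_; _◅◅_)
open import Relation.Binary.Construct.Closure.Symmetric using (fwd)

data Tile : Set where
  t1 t2 t3 : Tile

width : Tile → ℕ
width t1 = 1
width t2 = 2
width t3 = 3

block : ℕ → Tile → Word
block k t1 = suc k ∷ []
block k t2 = suc (suc k) ∷ suc k ∷ []
block k t3 = suc (suc (suc k)) ∷ suc (suc k) ∷ suc k ∷ []

render : ℕ → List Tile → Word
render k []       = []
render k (t ∷ ts) = block k t ++ render (width t + k) ts

offset : ℕ → List Tile → ℕ
offset k []       = k
offset k (t ∷ ts) = offset (width t + k) ts

size : List Tile → ℕ
size ts = sum (map width ts)

ones : ℕ → List Tile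
ones n = replicate n t1

size-ones : ∀ n → size (ones n) ≡ n
size-ones zero    = refl
size-ones (suc n) = cong suc (size-ones n)

ones-all : ∀ f → True (f t1) → ∀ n → True (all f (ones n))
ones-all f h zero    = _
ones-all f h (suc n) = Equivalence.from T-∧ (h , ones-all f h n)

render-++ : ∀ k a b → render k (a ++ b) ≡ render k a ++ render (offset k a) b
render-++ k []      b = refl
render-++ k (t ∷ a) b = trans (cong (block k t ++_) (render-++ (width t + k) a b))
                              (sym (++-assoc (block k t) (render (width t + k) a) _))

render-above : ∀ k ts → All (k <_) (render k ts)
render-above k []       = []
render-above k (t ∷ ts) =
  All.++⁺ (tile-above t) (All.map (<-trans (first-above t)) (render-above (width t + k) ts))
  where
  above : ∀ d → k < suc d + k
  above d = s≤s (m≤n+m k d)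
  tile-above : ∀ t → All (k <_) (block k t)
  tile-above t1 = above 0 ∷ []
  tile-above t2 = above 1 ∷ above 0 ∷ []
  tile-above t3 = above 2 ∷ above 1 ∷ above 0 ∷ []
  first-above : ∀ t → k < width t + k
  first-above t1 = above 0
  first-above t2 = above 1
  first-above t3 = above 2

-- Two blocks above the same value that start equally are the same tile (they start at width + k).
tile-cancel : ∀ k t u {xs ys} → block k t ++ xs ≡ block k u ++ ys → t ≡ u × xs ≡ ys
tile-cancel k t1 t1 eq = refl , ∷-injectiveʳ eq
tile-cancel k t2 t2 eq = refl , ∷-injectiveʳ (∷-injectiveʳ eq)
tile-cancel k t3 t3 eq = refl , ∷-injectiveʳ (∷-injectiveʳ (∷-injectiveʳ eq))
tile-cancel k t1 t2 ()
tile-cancel k t1 t3 ()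
tile-cancel k t2 t1 ()
tile-cancel k t2 t3 ()
tile-cancel k t3 t1 ()
tile-cancel k t3 t2 ()

render-prefix : ∀ k us ts suf → render k us ++ suf ≡ render k ts →
  ∃ λ b → ts ≡ us ++ b × suf ≡ render (offset k us) b
render-prefix k []        ts       suf eq = ts , refl , eq
render-prefix k (t1 ∷ us) []       suf ()
render-prefix k (t2 ∷ us) []       suf ()
render-prefix k (t3 ∷ us) []       suf ()
render-prefix k (u ∷ us)  (t ∷ ts) suf eq
  with refl , eq′ ← tile-cancel k u t (trans (sym (++-assoc (block k u) _ suf)) eq)
  with b , refl , suf≡ ← render-prefix (width u + k) us ts suf eq′
  = b , refl , suf≡

render-injective : ∀ k us ts → render k us ≡ render k ts → us ≡ ts
render-injective k us ts eq with render-prefix k us ts [] (trans (++-identityʳ _) eq)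
... | []     , refl , _ = sym (++-identityʳ us)
... | t1 ∷ _ , _ , ()
... | t2 ∷ _ , _ , ()
... | t3 ∷ _ , _ , ()

render-ones : ∀ n → render 0 (ones n) ≡ ι n
render-ones n = begin
  render 0 (ones n)               ≡⟨ from 0 n ⟩
  applyUpTo (λ i → suc (i + 0)) n ≡⟨ applyUpTo-cong (λ i → cong suc (+-identityʳ i)) n ⟩
  applyUpTo suc n                 ≡⟨ sym (map-upTo suc n) ⟩
  ι n                             ∎
  where
  open ≡-Reasoning
  applyUpTo-cong : ∀ {f g : ℕ → ℕ} → (∀ i → f i ≡ g i) → ∀ n → applyUpTo f n ≡ applyUpTo g n
  applyUpTo-cong f≗g zero    = refl
  applyUpTo-cong f≗g (suc n) = cong₂ _∷_ (f≗g 0) (applyUpTo-cong (λ i → f≗g (suc i)) n)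
  from : ∀ k n → render k (ones n) ≡ applyUpTo (λ i → suc (i + k)) n
  from k zero    = refl
  from k (suc n) = cong (suc k ∷_)
    (trans (from (suc k) n) (applyUpTo-cong (λ i → cong suc (+-suc i k)) n))

data Pat : Set where
  P123 P132 P213 P321 : Pat

word : Pat → Word
word P123 = p123
word P132 = p132
word P213 = p213
word P321 = p321

tl : Pat → List Tile
tl P123 = t1 ∷ t1 ∷ t1 ∷ []
tl P132 = t1 ∷ t2 ∷ []
tl P213 = t2 ∷ t1 ∷ []
tl P321 = t3 ∷ []

patterns : List Pat → List Word
patterns = map word

place-tl : ∀ m p → place m (word p) ≡ render m (tl p)
place-tl m p = trans (map-cong (λ i → +-comm m i) (word p)) (shape p)
  where
  shape : ∀ p → map (_+ m) (word p) ≡ render m (tl p)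
  shape P123 = refl
  shape P132 = refl
  shape P213 = refl
  shape P321 = refl

offset-tl : ∀ m p → offset m (tl p) ≡ 3 + m
offset-tl m P123 = refl
offset-tl m P132 = refl
offset-tl m P213 = refl
offset-tl m P321 = refl

-- An occurrence cannot start at the last entry of a block of width ≥ 2: the entries
-- after that block all exceed it by at least 2, but each pattern needs a nearer value.
no-start-at-last : ∀ m p k {w} suf →
  render m (tl p) ++ suf ≡ suc k ∷ w → All (suc (suc k) <_) w → ⊥
no-start-at-last m P123 k suf refl (lt ∷ _)     = m+n≮n 0 _ lt
no-start-at-last m P132 k suf refl (_ ∷ lt ∷ _) = m+n≮n 0 _ lt
no-start-at-last m P213 k suf refl (lt ∷ _)     = m+n≮n 2 _ lt
no-start-at-last m P321 k suf refl (lt ∷ _)     = m+n≮n 2 _ lt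

no-start-at-middle : ∀ m p k {w} suf →
  render m (tl p) ++ suf ≡ suc (suc k) ∷ suc k ∷ w → All (suc (suc (suc k)) <_) w → ⊥
no-start-at-middle m P123 k suf ()
no-start-at-middle m P132 k suf ()
no-start-at-middle m P213 k suf refl (lt ∷ _) = m+n≮n 0 _ lt
no-start-at-middle m P321 k suf refl (lt ∷ _) = m+n≮n 3 _ lt

first-tile : ∀ m p k t {w} suf →
  render m (tl p) ++ suf ≡ block k t ++ w → All (width t + k <_) w → m ≡ k
first-tile m P123 k t1 suf refl _        = refl
first-tile m P123 k t2 suf ()
first-tile m P123 k t3 suf ()
first-tile m P132 k t1 suf refl _        = refl
first-tile m P132 k t2 suf ()
first-tile m P132 k t3 suf ()
first-tile m P213 k t1 suf refl (lt ∷ _) = ⊥-elim (m+n≮n 1 _ lt)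
first-tile m P213 k t2 suf refl _        = refl
first-tile m P213 k t3 suf ()
first-tile m P321 k t1 suf refl (lt ∷ _) = ⊥-elim (m+n≮n 1 _ lt)
first-tile m P321 k t2 suf refl (lt ∷ _) = ⊥-elim (m+n≮n 2 _ lt)
first-tile m P321 k t3 suf refl _        = refl

occurrence-aligned : ∀ m p k ts suf → render m (tl p) ++ suf ≡ render k ts → m ≡ k
occurrence-aligned m p    k (t ∷ ts) suf eq = first-tile m p k t suf eq (render-above (width t + k) ts)
occurrence-aligned m P123 k []       suf ()
occurrence-aligned m P132 k []       suf ()
occurrence-aligned m P213 k []       suf ()
occurrence-aligned m P321 k []       suf ()

TileSplit : Word → Word → ℕ → Pat → ℕ → List Tile → Set
TileSplit pre suf m p k ts = ∃₂ λ a b →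
  ts ≡ a ++ tl p ++ b × pre ≡ render k a × m ≡ offset k a × suf ≡ render (3 + m) b

split-cons : ∀ t {pre suf m p k ts} →
  TileSplit pre suf m p (width t + k) ts → TileSplit (block k t ++ pre) suf m p k (t ∷ ts)
split-cons t (a , b , refl , refl , refl , refl) = t ∷ a , b , refl , refl , refl , refl

-- Walk along ts; the occurrence cannot begin inside a block (no-start-at-last, no-start-at-middle),
-- and once it begins at a block it is aligned with the tiling (occurrence-aligned).
decompose : ∀ pre suf m p k ts → pre ++ render m (tl p) ++ suf ≡ render k ts → TileSplit pre suf m p k ts
decompose [] suf m p k ts eq
  with refl ← occurrence-aligned m p k ts suf eq
  with b , refl , suf≡ ← render-prefix m (tl p) ts suf eq
  = [] , b , refl , refl , refl , trans suf≡ (cong (λ j → render j b) (offset-tl m p))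
decompose (x ∷ pre) suf m p k [] ()
decompose (x ∷ pre) suf m p k (t1 ∷ ts) eq
  with refl ← ∷-injectiveˡ eq
  = split-cons t1 (decompose pre suf m p (suc k) ts (∷-injectiveʳ eq))
decompose (x ∷ []) suf m p k (t2 ∷ ts) eq =
  ⊥-elim (no-start-at-last m p k suf (∷-injectiveʳ eq) (render-above (2 + k) ts))
decompose (x ∷ y ∷ pre) suf m p k (t2 ∷ ts) eq
  with refl ← ∷-injectiveˡ eq | refl ← ∷-injectiveˡ (∷-injectiveʳ eq)
  = split-cons t2 (decompose pre suf m p (2 + k) ts (∷-injectiveʳ (∷-injectiveʳ eq)))
decompose (x ∷ []) suf m p k (t3 ∷ ts) eq =
  ⊥-elim (no-start-at-middle m p k suf (∷-injectiveʳ eq) (render-above (3 + k) ts))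
decompose (x ∷ y ∷ []) suf m p k (t3 ∷ ts) eq =
  ⊥-elim (no-start-at-last m p k suf (∷-injectiveʳ (∷-injectiveʳ eq))
    (All.map (<-trans (n<1+n _)) (render-above (3 + k) ts)))
decompose (x ∷ y ∷ z ∷ pre) suf m p k (t3 ∷ ts) eq
  with refl ← ∷-injectiveˡ eq | refl ← ∷-injectiveˡ (∷-injectiveʳ eq)
     | refl ← ∷-injectiveˡ (∷-injectiveʳ (∷-injectiveʳ eq))
  = split-cons t3 (decompose pre suf m p (3 + k) ts (∷-injectiveʳ (∷-injectiveʳ (∷-injectiveʳ eq))))

data Rewrite (ps : List Pat) : List Tile → List Tile → Set where
  swap : ∀ a b {p p′} → p ∈ ps → p′ ∈ ps → Rewrite ps (a ++ tl p ++ b) (a ++ tl p′ ++ b)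

occurrence-render : ∀ k a p b →
  render k a ++ place (offset k a) (word p) ++ render (3 + offset k a) b ≡ render k (a ++ tl p ++ b)
occurrence-render k a p b = begin
  render k a ++ place j (word p) ++ render (3 + j) b
    ≡⟨ cong (λ w → render k a ++ w ++ render (3 + j) b) (place-tl j p) ⟩
  render k a ++ render j (tl p) ++ render (3 + j) b
    ≡⟨ cong (λ i → render k a ++ render j (tl p) ++ render i b) (sym (offset-tl j p)) ⟩
  render k a ++ render j (tl p) ++ render (offset j (tl p)) b
    ≡⟨ cong (render k a ++_) (sym (render-++ j (tl p) b)) ⟩
  render k a ++ render j (tl p ++ b)
    ≡⟨ sym (render-++ k a (tl p ++ b)) ⟩
  render k (a ++ tl p ++ b) ∎
  where
  open ≡-Reasoning
  j = offset k a

Reachable : List Pat → List Tile → List Tile → Set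
Reachable ps = EqClosure (Rewrite ps)

module _ {ps : List Pat} where

  rewrite⇒move : ∀ k {x y} → Rewrite ps x y → Move (patterns ps) (render k x) (render k y)
  rewrite⇒move k (swap a b {p} {p′} p∈ p′∈) =
    subst₂ (Move (patterns ps)) (occurrence-render k a p b) (occurrence-render k a p′ b)
      (move (render k a) (render (3 + offset k a) b) (offset k a) (word p) (word p′)
            (∈-map⁺ word p∈) (∈-map⁺ word p′∈))

  move⇒rewrite : ∀ k ts {π ρ} → Move (patterns ps) π ρ → π ≡ render k ts →
    ∃ λ ts′ → Rewrite ps ts ts′ × ρ ≡ render k ts′
  move⇒rewrite k ts (move pre suf m σ σ′ σ∈ σ′∈) eq
    with p , p∈ , refl ← ∈-map⁻ word σ∈
    with p′ , p′∈ , refl ← ∈-map⁻ word σ′∈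
    with a , b , refl , refl , refl , refl ←
         decompose pre suf m p k ts (trans (cong (λ w → pre ++ w ++ suf) (sym (place-tl m p))) eq)
    = a ++ tl p′ ++ b , swap a b p∈ p′∈ , occurrence-render k a p′ b

  -- Rewrites preserve the size of a tiling, since every pattern tiling has size 3.
  rewrite-size : ∀ {x y} → Rewrite ps x y → size x ≡ size y
  rewrite-size (swap a b {p} {p′} _ _) = go a
    where
    size-tl : ∀ p → size (tl p ++ b) ≡ 3 + size b
    size-tl P123 = refl
    size-tl P132 = refl
    size-tl P213 = refl
    size-tl P321 = refl
    go : ∀ a → size (a ++ tl p ++ b) ≡ size (a ++ tl p′ ++ b)
    go []      = trans (size-tl p) (sym (size-tl p′))
    go (t ∷ a) = cong (width t +_) (go a)

  rewrite-at : ∀ a b {p p′} → p ∈ ps → p′ ∈ ps → Reachable ps (a ++ tl p ++ b) (a ++ tl p′ ++ b)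
  rewrite-at a b p∈ p′∈ = fwd (swap a b p∈ p′∈) ◅ ε

  cons-cong : ∀ t {x y} → Reachable ps x y → Reachable ps (t ∷ x) (t ∷ y)
  cons-cong t = gmap (t ∷_) shift
    where
    shift : ∀ {x y} → Rewrite ps x y → Rewrite ps (t ∷ x) (t ∷ y)
    shift (swap a b p∈ p′∈) = swap (t ∷ a) b p∈ p′∈

Invariant : List Pat → (List Tile → Bool) → Set
Invariant ps V = ∀ {x y} → Rewrite ps x y → V x ≡ V y

startsWith : (Tile → Bool) → List Tile → Bool
startsWith f []      = false
startsWith f (t ∷ _) = f t

module _ {ps : List Pat} where

  ∧-invariant : ∀ {V W} → Invariant ps V → Invariant ps W → Invariant ps (λ x → V x ∧ W x)
  ∧-invariant V-inv W-inv r = cong₂ _∧_ (V-inv r) (W-inv r)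

  not-invariant : ∀ {V} → Invariant ps V → Invariant ps (λ x → not (V x))
  not-invariant V-inv r = cong not (V-inv r)

  all-invariant : ∀ f → All (λ p → all f (tl p) ≡ true) ps → Invariant ps (all f)
  all-invariant f hyp (swap a b {p} {p′} p∈ p′∈) = go a
    where
    drop-true : ∀ xs {ys} → all f xs ≡ true → all f (xs ++ ys) ≡ all f ys
    drop-true []       _ = refl
    drop-true (x ∷ xs) h with f x
    drop-true (x ∷ xs) h  | true = drop-true xs h
    drop-true (x ∷ xs) () | false
    go : ∀ a → all f (a ++ tl p ++ b) ≡ all f (a ++ tl p′ ++ b)
    go []      = trans (drop-true (tl p) (lookup hyp p∈)) (sym (drop-true (tl p′) (lookup hyp p′∈)))
    go (t ∷ a) = cong (f t ∧_) (go a)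

  any-invariant : ∀ f → All (λ p → any f (tl p) ≡ true) ps → Invariant ps (any f)
  any-invariant f hyp (swap a b {p} {p′} p∈ p′∈) = go a
    where
    keep-true : ∀ xs {ys} → any f xs ≡ true → any f (xs ++ ys) ≡ true
    keep-true (x ∷ xs) h with f x
    keep-true (x ∷ xs) h | true  = refl
    keep-true (x ∷ xs) h | false = keep-true xs h
    go : ∀ a → any f (a ++ tl p ++ b) ≡ any f (a ++ tl p′ ++ b)
    go []      = trans (keep-true (tl p) (lookup hyp p∈)) (sym (keep-true (tl p′) (lookup hyp p′∈)))
    go (t ∷ a) = cong (f t ∨_) (go a)

  startsWith-invariant : ∀ f c → All (λ p → startsWith f (tl p) ≡ c) ps → Invariant ps (startsWith f)
  startsWith-invariant f c hyp (swap [] b {p} {p′} p∈ p′∈) =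
    trans (first p) (trans (lookup hyp p∈) (sym (trans (first p′) (lookup hyp p′∈))))
    where
    first : ∀ p → startsWith f (tl p ++ b) ≡ startsWith f (tl p)
    first P123 = refl
    first P132 = refl
    first P213 = refl
    first P321 = refl
  startsWith-invariant f c hyp (swap (t ∷ a) b p∈ p′∈) = refl

isOne isTwo isThree : Tile → Bool
isOne t1 = true
isOne _  = false
isTwo t2 = true
isTwo _  = false
isThree t3 = true
isThree _  = false

parts12 parts13 hasNonTwo : List Tile → Bool
parts12   = all (λ t → not (isThree t))
parts13   = all (λ t → not (isTwo t))
hasNonTwo = any (λ t → not (isTwo t))

-- Enumeration of tilings: comps n lists the tilings of n, comps₂ n those of n + 1 with
-- first part ≥ 2, and comps₃ n those of n + 2 with first part 3.
comps comps₂ comps₃ : ℕ → List (List Tile)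
comps zero     = [] ∷ []
comps (suc n)  = map (t1 ∷_) (comps n) ++ comps₂ n
comps₂ zero    = []
comps₂ (suc n) = map (t2 ∷_) (comps n) ++ comps₃ n
comps₃ zero    = []
comps₃ (suc n) = map (t3 ∷_) (comps n)

comps-size  : ∀ n {ts} → ts ∈ comps n → size ts ≡ n
comps₂-size : ∀ n {ts} → ts ∈ comps₂ n → size ts ≡ suc n
comps₃-size : ∀ n {ts} → ts ∈ comps₃ n → size ts ≡ suc (suc n)
comps-size zero (here refl) = refl
comps-size (suc n) ts∈ with ∈-++⁻ (map (t1 ∷_) (comps n)) ts∈
... | inj₁ ts∈₁ with r , r∈ , refl ← ∈-map⁻ (t1 ∷_) ts∈₁ = cong suc (comps-size n r∈)
... | inj₂ ts∈₂ = comps₂-size n ts∈₂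
comps₂-size (suc n) ts∈ with ∈-++⁻ (map (t2 ∷_) (comps n)) ts∈
... | inj₁ ts∈₁ with r , r∈ , refl ← ∈-map⁻ (t2 ∷_) ts∈₁ = cong (2 +_) (comps-size n r∈)
... | inj₂ ts∈₃ = comps₃-size n ts∈₃
comps₃-size (suc n) ts∈ with r , r∈ , refl ← ∈-map⁻ (t3 ∷_) ts∈ = cong (3 +_) (comps-size n r∈)

comps-complete : ∀ ts → ts ∈ comps (size ts)
comps-complete []        = here refl
comps-complete (t1 ∷ ts) = ∈-++⁺ˡ (∈-map⁺ (t1 ∷_) (comps-complete ts))
comps-complete (t2 ∷ ts) =
  ∈-++⁺ʳ (map (t1 ∷_) (comps (1 + size ts))) (∈-++⁺ˡ (∈-map⁺ (t2 ∷_) (comps-complete ts)))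
comps-complete (t3 ∷ ts) =
  ∈-++⁺ʳ (map (t1 ∷_) (comps (2 + size ts)))
    (∈-++⁺ʳ (map (t2 ∷_) (comps (1 + size ts))) (∈-map⁺ (t3 ∷_) (comps-complete ts)))

comps₃-first : ∀ n {ts} → ts ∈ comps₃ n → ∃ λ r → ts ≡ t3 ∷ r
comps₃-first (suc n) ts∈ with r , _ , refl ← ∈-map⁻ (t3 ∷_) ts∈ = r , refl

comps₂-not-t1 : ∀ n {r} → t1 ∷ r ∈ comps₂ n → ⊥
comps₂-not-t1 (suc n) ts∈ with ∈-++⁻ (map (t2 ∷_) (comps n)) ts∈
... | inj₁ ts∈₁ with _ , _ , () ← ∈-map⁻ (t2 ∷_) ts∈₁
... | inj₂ ts∈₃ with _ , () ← comps₃-first n ts∈₃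

comps-unique  : ∀ n → Unique (comps n)
comps₂-unique : ∀ n → Unique (comps₂ n)
comps₃-unique : ∀ n → Unique (comps₃ n)
comps-unique zero = [] ∷ []
comps-unique (suc n) = Unique.++⁺ (Unique.map⁺ ∷-injectiveʳ (comps-unique n)) (comps₂-unique n) disjoint
  where
  disjoint : ∀ {ts} → ts ∈ map (t1 ∷_) (comps n) × ts ∈ comps₂ n → ⊥
  disjoint (ts∈₁ , ts∈₂) with r , _ , refl ← ∈-map⁻ (t1 ∷_) ts∈₁ = comps₂-not-t1 n ts∈₂
comps₂-unique zero = []
comps₂-unique (suc n) = Unique.++⁺ (Unique.map⁺ ∷-injectiveʳ (comps-unique n)) (comps₃-unique n) disjoint
  where
  disjoint : ∀ {ts} → ts ∈ map (t2 ∷_) (comps n) × ts ∈ comps₃ n → ⊥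
  disjoint (ts∈₁ , ts∈₃) with r , _ , refl ← ∈-map⁻ (t2 ∷_) ts∈₁ with _ , () ← comps₃-first n ts∈₃
comps₃-unique zero = []
comps₃-unique (suc n) = Unique.map⁺ ∷-injectiveʳ (comps-unique n)

count : {A : Set} → (A → Bool) → List A → ℕ
count V xs = length (filterᵇ V xs)

module _ {A : Set} where

  count-++ : ∀ (V : A → Bool) xs ys → count V (xs ++ ys) ≡ count V xs + count V ys
  count-++ V xs ys = trans (cong length (filter-++ (T? ∘ V) xs ys)) (length-++ (filterᵇ V xs))

  count-map : ∀ {B : Set} (V : B → Bool) (f : A → B) xs → count V (map f xs) ≡ count (V ∘ f) xs
  count-map V f []       = refl
  count-map V f (x ∷ xs) with V (f x)
  ... | true  = cong suc (count-map V f xs)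
  ... | false = count-map V f xs

  count-false : ∀ (xs : List A) → count (λ _ → false) xs ≡ 0
  count-false []       = refl
  count-false (x ∷ xs) = count-false xs

  count-cong : ∀ {V W : A → Bool} → (∀ x → V x ≡ W x) → ∀ xs → count V xs ≡ count W xs
  count-cong         V≗W []       = refl
  count-cong {V} {W} V≗W (x ∷ xs) with V x | W x | V≗W x
  ... | true  | .true  | refl = cong suc (count-cong V≗W xs)
  ... | false | .false | refl = count-cong V≗W xs

  count-split : ∀ (P W : A → Bool) xs →
    count W xs ≡ count (λ x → P x ∧ W x) xs + count (λ x → not (P x) ∧ W x) xs
  count-split P W []       = refl
  count-split P W (x ∷ xs) with P x | W x
  ... | true  | true  = cong suc (count-split P W xs)
  ... | false | true  = trans (cong suc (count-split P W xs)) (sym (+-suc _ _))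
  ... | true  | false = count-split P W xs
  ... | false | false = count-split P W xs

count-comps : ∀ V n → count V (comps (3 + n)) ≡
  count (λ x → V (t1 ∷ x)) (comps (2 + n)) + count (λ x → V (t2 ∷ x)) (comps (1 + n))
    + count (λ x → V (t3 ∷ x)) (comps n)
count-comps V n = begin
  count V (comps (3 + n))                 ≡⟨⟩
  count V (M₁ ++ M₂ ++ M₃)                ≡⟨ count-++ V M₁ (M₂ ++ M₃) ⟩
  count V M₁ + count V (M₂ ++ M₃)         ≡⟨ cong (count V M₁ +_) (count-++ V M₂ M₃) ⟩
  count V M₁ + (count V M₂ + count V M₃)  ≡⟨ sym (+-assoc (count V M₁) _ _) ⟩
  count V M₁ + count V M₂ + count V M₃
    ≡⟨ cong₂ _+_ (cong₂ _+_ (count-map V (t1 ∷_) (comps (2 + n))) (count-map V (t2 ∷_) (comps (1 + n))))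
                 (count-map V (t3 ∷_) (comps n)) ⟩
  count (λ x → V (t1 ∷ x)) (comps (2 + n)) + count (λ x → V (t2 ∷ x)) (comps (1 + n))
    + count (λ x → V (t3 ∷ x)) (comps n) ∎
  where
  open ≡-Reasoning
  M₁ = map (t1 ∷_) (comps (2 + n))
  M₂ = map (t2 ∷_) (comps (1 + n))
  M₃ = map (t3 ∷_) (comps n)

-- Moves can be undone: B is used for both the removed and the inserted pattern.
move-sym : ∀ {B x y} → Move B x y → Move B y x
move-sym (move pre suf m σ σ′ σ∈ σ′∈) = move pre suf m σ′ σ σ′∈ σ∈

Layered : (List Tile → Bool) → ℕ → Word → Set
Layered V n π = ∃ λ ts → True (V ts) × size ts ≡ n × π ≡ render 0 ts

module _ {ps : List Pat} where

  layered-step : ∀ {V n π ρ} → Invariant ps V → Move (patterns ps) π ρ → Layered V n π → Layered V n ρ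
  layered-step inv m (ts , v , refl , refl)
    with ts′ , r , refl ← move⇒rewrite 0 ts m refl
    = ts′ , subst True (inv r) v , sym (rewrite-size r) , refl

  layered-equiv : ∀ {V n π ρ} → Invariant ps V → DAEquiv (patterns ps) π ρ → Layered V n π ⇔ Layered V n ρ
  layered-equiv {V} {n} inv =
    fold (On.isEquivalence (Layered V n) ⇔-isEquivalence)
         (λ m → mk⇔ (layered-step inv m) (layered-step inv (move-sym m)))

class-size : ∀ ps V n → Invariant ps V → True (V (ones n)) →
  (∀ ts → True (V ts) → Reachable ps ts (ones (size ts))) →
  IsClassSize (patterns ps) n (count V (comps n))
class-size ps V n inv base reach =
  map (render 0) L ,
  Unique.map⁺ (render-injective 0 _ _) (Unique.filter⁺ (T? ∘ V) (comps-unique n)) ,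
  (λ π → mk⇔ (sound π) (complete π)) ,
  length-map (render 0) L
  where
  L = filterᵇ V (comps n)
  sound : ∀ π → π ∈ map (render 0) L → DAEquiv (patterns ps) π (ι n)
  sound π π∈
    with ts , ts∈L , refl ← ∈-map⁻ (render 0) π∈
    with ts∈ , v ← ∈-filter⁻ (T? ∘ V) ts∈L
    with refl ← comps-size n ts∈
    = subst (DAEquiv (patterns ps) (render 0 ts)) (render-ones (size ts))
        (gmap (render 0) (rewrite⇒move 0) (reach ts v))
  complete : ∀ π → DAEquiv (patterns ps) π (ι n) → π ∈ map (render 0) L
  complete π π∼ι
    with ts , v , refl , refl ← Equivalence.from (layered-equiv inv π∼ι)
                                 (ones n , base , size-ones n , sym (render-ones n))
    = ∈-map⁺ (render 0) (∈-filter⁺ (T? ∘ V) (comps-complete ts) v)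

module _ {ps : List Pat} (123∈ : P123 ∈ ps) where

  -- With 123, 132 ∈ B: a tiling 1·r with parts 1, 2 rewrites to 1ⁿ (each 1·2 becomes 1·1·1).
  ones-after-t1₁₂ : P132 ∈ ps → ∀ r → True (parts12 r) → Reachable ps (t1 ∷ r) (ones (1 + size r))
  ones-after-t1₁₂ 132∈ []       _ = ε
  ones-after-t1₁₂ 132∈ (t1 ∷ r) v = cons-cong t1 (ones-after-t1₁₂ 132∈ r v)
  ones-after-t1₁₂ 132∈ (t2 ∷ r) v =
    rewrite-at [] r 132∈ 123∈ ◅◅ cons-cong t1 (cons-cong t1 (ones-after-t1₁₂ 132∈ r v))
  ones-after-t1₁₂ 132∈ (t3 ∷ r) ()

  -- With 123, 132, 321 ∈ B: every tiling 1·r rewrites to 1ⁿ (also 1·3 becomes 1·1·1·1).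
  ones-after-t1 : P132 ∈ ps → P321 ∈ ps → ∀ r → Reachable ps (t1 ∷ r) (ones (1 + size r))
  ones-after-t1 132∈ 321∈ []       = ε
  ones-after-t1 132∈ 321∈ (t1 ∷ r) = cons-cong t1 (ones-after-t1 132∈ 321∈ r)
  ones-after-t1 132∈ 321∈ (t2 ∷ r) =
    rewrite-at [] r 132∈ 123∈ ◅◅ cons-cong t1 (cons-cong t1 (ones-after-t1 132∈ 321∈ r))
  ones-after-t1 132∈ 321∈ (t3 ∷ r) =
    rewrite-at (t1 ∷ []) r 321∈ 123∈ ◅◅ cons-cong t1 (cons-cong t1 (cons-cong t1 (ones-after-t1 132∈ 321∈ r)))

  three-to-ones : P132 ∈ ps → P321 ∈ ps → ∀ r → Reachable ps (t3 ∷ r) (ones (3 + size r))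
  three-to-ones 132∈ 321∈ r =
    rewrite-at [] r 321∈ 123∈ ◅◅ cons-cong t1 (cons-cong t1 (ones-after-t1 132∈ 321∈ r))

  ones-from-13 : P321 ∈ ps → ∀ r → True (parts13 r) → Reachable ps r (ones (size r))
  ones-from-13 321∈ []       _ = ε
  ones-from-13 321∈ (t1 ∷ r) v = cons-cong t1 (ones-from-13 321∈ r v)
  ones-from-13 321∈ (t3 ∷ r) v =
    rewrite-at [] r 321∈ 123∈ ◅◅ cons-cong t1 (cons-cong t1 (cons-cong t1 (ones-from-13 321∈ r v)))
  ones-from-13 321∈ (t2 ∷ r) ()

  absorb-two : P213 ∈ ps → ∀ {r} m → Reachable ps r (ones (suc m)) → Reachable ps (t2 ∷ r) (ones (3 + m))
  absorb-two 213∈ m r∼ = cons-cong t2 r∼ ◅◅ rewrite-at [] (ones m) 213∈ 123∈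

count-12 : ∀ n → count parts12 (comps n) ≡ F (suc n)
count-12 0 = refl
count-12 1 = refl
count-12 2 = refl
count-12 (suc (suc (suc n))) = begin
  count parts12 (comps (3 + n))
    ≡⟨ count-comps parts12 n ⟩
  count parts12 (comps (2 + n)) + count parts12 (comps (1 + n)) + count (λ _ → false) (comps n)
    ≡⟨ cong₂ _+_ (cong₂ _+_ (count-12 (suc (suc n))) (count-12 (suc n))) (count-false (comps n)) ⟩
  F (3 + n) + F (2 + n) + 0
    ≡⟨ +-identityʳ _ ⟩
  F (4 + n) ∎
  where open ≡-Reasoning

count-13 : ∀ n → count parts13 (comps n) ≡ A2 n
count-13 0 = refl
count-13 1 = refl
count-13 2 = refl
count-13 (suc (suc (suc n))) = begin
  count parts13 (comps (3 + n))
    ≡⟨ count-comps parts13 n ⟩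
  count parts13 (comps (2 + n)) + count (λ _ → false) (comps (1 + n)) + count parts13 (comps n)
    ≡⟨ cong₂ _+_ (cong₂ _+_ (count-13 (suc (suc n))) (count-false (comps (1 + n)))) (count-13 n) ⟩
  A2 (2 + n) + 0 + A2 n
    ≡⟨ cong (_+ A2 n) (+-identityʳ _) ⟩
  A2 (3 + n) ∎
  where open ≡-Reasoning

count-all : ∀ n → count (λ _ → true) (comps n) ≡ T (2 + n)
count-all 0 = refl
count-all 1 = refl
count-all 2 = refl
count-all (suc (suc (suc n))) = begin
  count (λ _ → true) (comps (3 + n))
    ≡⟨ count-comps (λ _ → true) n ⟩
  count (λ _ → true) (comps (2 + n)) + count (λ _ → true) (comps (1 + n)) + count (λ _ → true) (comps n)
    ≡⟨ cong₂ _+_ (cong₂ _+_ (count-all (suc (suc n))) (count-all (suc n))) (count-all n) ⟩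
  T (5 + n) ∎
  where open ≡-Reasoning

-- The only tiling without a part ≠ 2 is 2^(n/2), present iff n is even.
count-twos : ∀ n → count (λ x → not (hasNonTwo x)) (comps n) ≡ evenInd n
count-twos 0 = refl
count-twos 1 = refl
count-twos 2 = refl
count-twos (suc (suc (suc n))) = begin
  count (λ x → not (hasNonTwo x)) (comps (3 + n))
    ≡⟨ count-comps (λ x → not (hasNonTwo x)) n ⟩
  count (λ _ → false) (comps (2 + n)) + count (λ x → not (hasNonTwo x)) (comps (1 + n))
    + count (λ _ → false) (comps n)
    ≡⟨ cong₂ _+_ (cong₂ _+_ (count-false (comps (2 + n))) (count-twos (suc n))) (count-false (comps n)) ⟩
  evenInd (1 + n) + 0
    ≡⟨ +-identityʳ _ ⟩
  evenInd (3 + n) ∎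
  where open ≡-Reasoning

count-nonTwos : ∀ Q → (∀ x → not (hasNonTwo x) ∧ Q x ≡ not (hasNonTwo x)) → ∀ n →
  count (λ x → hasNonTwo x ∧ Q x) (comps n) ≡ count Q (comps n) ∸ evenInd n
count-nonTwos Q twos-in-Q n = begin
  count (λ x → hasNonTwo x ∧ Q x) (comps n)
    ≡⟨ sym (m+n∸n≡m _ (evenInd n)) ⟩
  count (λ x → hasNonTwo x ∧ Q x) (comps n) + evenInd n ∸ evenInd n
    ≡⟨ cong (λ c → count (λ x → hasNonTwo x ∧ Q x) (comps n) + c ∸ evenInd n)
            (sym (trans (count-cong twos-in-Q (comps n)) (count-twos n))) ⟩
  count (λ x → hasNonTwo x ∧ Q x) (comps n) + count (λ x → not (hasNonTwo x) ∧ Q x) (comps n) ∸ evenInd n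
    ≡⟨ cong (_∸ evenInd n) (sym (count-split hasNonTwo Q (comps n))) ⟩
  count Q (comps n) ∸ evenInd n ∎
  where open ≡-Reasoning

A4-tribonacci : ∀ n → A4 (suc n) ≡ T (2 + n) + T n
A4-tribonacci 0 = refl
A4-tribonacci 1 = refl
A4-tribonacci 2 = refl
A4-tribonacci (suc (suc (suc n))) = begin
  A4 (3 + n) + A4 (2 + n) + A4 (1 + n)
    ≡⟨ cong₂ _+_ (cong₂ _+_ (A4-tribonacci (suc (suc n))) (A4-tribonacci (suc n))) (A4-tribonacci n) ⟩
  (T (4 + n) + T (2 + n)) + (T (3 + n) + T (1 + n)) + (T (2 + n) + T n)
    ≡⟨ regroup (T (4 + n)) (T (3 + n)) (T (2 + n)) (T (1 + n)) (T n) ⟩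
  T (5 + n) + T (3 + n) ∎
  where
  open ≡-Reasoning
  regroup : ∀ a b c d e → (a + c) + (b + d) + (c + e) ≡ (a + b + c) + (c + d + e)
  regroup = solve-∀

twos-are-12 : ∀ x → not (hasNonTwo x) ∧ parts12 x ≡ not (hasNonTwo x)
twos-are-12 []       = refl
twos-are-12 (t1 ∷ x) = refl
twos-are-12 (t2 ∷ x) = twos-are-12 x
twos-are-12 (t3 ∷ x) = refl

case-i : ∀ n → 1 ≤ n → IsClassSize (p123 ∷ p132 ∷ []) n (F n)
case-i n@(suc j) _ =
  subst (IsClassSize (patterns ps) n) (counted n) (class-size ps V n invariant (ones-all _ _ j) reach)
  where
  ps = P123 ∷ P132 ∷ []
  V : List Tile → Bool
  V x = startsWith isOne x ∧ parts12 x
  invariant : Invariant ps V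
  invariant = ∧-invariant (startsWith-invariant isOne true (refl ∷ refl ∷ []))
                          (all-invariant _ (refl ∷ refl ∷ []))
  reach : ∀ ts → True (V ts) → Reachable ps ts (ones (size ts))
  reach (t1 ∷ r) v = ones-after-t1₁₂ (here refl) (there (here refl)) r v
  reach [] ()
  reach (t2 ∷ r) ()
  reach (t3 ∷ r) ()
  counted : ∀ n → count V (comps n) ≡ F n
  counted 0 = refl
  counted 1 = refl
  counted 2 = refl
  counted (suc (suc (suc n))) = begin
    count V (comps (3 + n))
      ≡⟨ count-comps V n ⟩
    count parts12 (comps (2 + n)) + count (λ _ → false) (comps (1 + n)) + count (λ _ → false) (comps n)
      ≡⟨ cong₂ _+_ (cong₂ _+_ (count-12 (2 + n)) (count-false (comps (1 + n)))) (count-false (comps n)) ⟩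
    F (3 + n) + 0 + 0
      ≡⟨ trans (+-identityʳ _) (+-identityʳ _) ⟩
    F (3 + n) ∎
    where open ≡-Reasoning

case-ii : ∀ n → 1 ≤ n → IsClassSize (p123 ∷ p321 ∷ []) n (A2 n)
case-ii n _ =
  subst (IsClassSize (patterns ps) n) (count-13 n)
    (class-size ps parts13 n (all-invariant _ (refl ∷ refl ∷ [])) (ones-all _ _ n)
                (ones-from-13 (here refl) (there (here refl))))
  where
  ps = P123 ∷ P321 ∷ []

case-iii : ∀ n → 1 ≤ n → IsClassSize (p123 ∷ p132 ∷ p213 ∷ []) n (F (n + 1) ∸ evenInd n)
case-iii n@(suc j) _ =
  subst (IsClassSize (patterns ps) n) counted (class-size ps V n invariant (ones-all _ _ j) reach)
  where
  ps = P123 ∷ P132 ∷ P213 ∷ []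
  V : List Tile → Bool
  V x = hasNonTwo x ∧ parts12 x
  invariant : Invariant ps V
  invariant = ∧-invariant (any-invariant _ (refl ∷ refl ∷ refl ∷ []))
                          (all-invariant _ (refl ∷ refl ∷ refl ∷ []))
  123∈ : P123 ∈ ps
  123∈ = here refl
  213∈ : P213 ∈ ps
  213∈ = there (there (here refl))
  reach : ∀ ts → True (V ts) → Reachable ps ts (ones (size ts))
  reach (t1 ∷ r)      v = ones-after-t1₁₂ 123∈ (there (here refl)) r v
  reach (t2 ∷ t1 ∷ r) v = absorb-two 123∈ 213∈ (size r) (reach (t1 ∷ r) v)
  reach (t2 ∷ t2 ∷ r) v = absorb-two 123∈ 213∈ (suc (size r)) (reach (t2 ∷ r) v)
  reach []            ()
  reach (t2 ∷ [])     ()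
  reach (t2 ∷ t3 ∷ r) ()
  reach (t3 ∷ r)      ()
  counted : count V (comps n) ≡ F (n + 1) ∸ evenInd n
  counted = begin
    count V (comps n)                    ≡⟨ count-nonTwos parts12 twos-are-12 n ⟩
    count parts12 (comps n) ∸ evenInd n  ≡⟨ cong (_∸ evenInd n) (count-12 n) ⟩
    F (1 + n) ∸ evenInd n                ≡⟨ cong (λ m → F m ∸ evenInd n) (+-comm 1 n) ⟩
    F (n + 1) ∸ evenInd n                ∎
    where open ≡-Reasoning

case-iv : ∀ n → 1 ≤ n → IsClassSize (p123 ∷ p132 ∷ p321 ∷ []) n (A4 n)
case-iv n _ =
  subst (IsClassSize (patterns ps) n) (counted n) (class-size ps V n invariant (base n) reach)
  where
  ps = P123 ∷ P132 ∷ P321 ∷ []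
  V : List Tile → Bool
  V x = not (startsWith isTwo x)
  invariant : Invariant ps V
  invariant = not-invariant (startsWith-invariant isTwo false (refl ∷ refl ∷ refl ∷ []))
  base : ∀ n → True (V (ones n))
  base zero    = _
  base (suc n) = _
  123∈ : P123 ∈ ps
  123∈ = here refl
  132∈ : P132 ∈ ps
  132∈ = there (here refl)
  321∈ : P321 ∈ ps
  321∈ = there (there (here refl))
  reach : ∀ ts → True (V ts) → Reachable ps ts (ones (size ts))
  reach []       _ = ε
  reach (t1 ∷ r) _ = ones-after-t1 123∈ 132∈ 321∈ r
  reach (t3 ∷ r) _ = three-to-ones 123∈ 132∈ 321∈ r
  reach (t2 ∷ r) ()
  counted : ∀ n → count V (comps n) ≡ A4 n
  counted 0 = refl
  counted 1 = refl
  counted 2 = refl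
  counted (suc (suc (suc n))) = begin
    count V (comps (3 + n))
      ≡⟨ count-comps V n ⟩
    count (λ _ → true) (comps (2 + n)) + count (λ _ → false) (comps (1 + n)) + count (λ _ → true) (comps n)
      ≡⟨ cong₂ _+_ (cong₂ _+_ (count-all (2 + n)) (count-false (comps (1 + n)))) (count-all n) ⟩
    T (4 + n) + 0 + T (2 + n)
      ≡⟨ cong (_+ T (2 + n)) (+-identityʳ _) ⟩
    T (4 + n) + T (2 + n)
      ≡⟨ sym (A4-tribonacci (2 + n)) ⟩
    A4 (3 + n) ∎
    where open ≡-Reasoning

case-v : ∀ n → 1 ≤ n → IsClassSize (p123 ∷ p132 ∷ p213 ∷ p321 ∷ []) n (T (n + 2) ∸ evenInd n)
case-v n@(suc j) _ =
  subst (IsClassSize (patterns ps) n) counted (class-size ps V n invariant _ reach)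
  where
  ps = P123 ∷ P132 ∷ P213 ∷ P321 ∷ []
  -- written as hasNonTwo ∧ Q with Q constantly true, the form counted by count-nonTwos
  V : List Tile → Bool
  V x = hasNonTwo x ∧ true
  invariant : Invariant ps V
  invariant = ∧-invariant (any-invariant _ (refl ∷ refl ∷ refl ∷ refl ∷ [])) (λ _ → refl)
  123∈ : P123 ∈ ps
  123∈ = here refl
  132∈ : P132 ∈ ps
  132∈ = there (here refl)
  213∈ : P213 ∈ ps
  213∈ = there (there (here refl))
  321∈ : P321 ∈ ps
  321∈ = there (there (there (here refl)))
  reach : ∀ ts → True (V ts) → Reachable ps ts (ones (size ts))
  reach (t1 ∷ r)      _ = ones-after-t1 123∈ 132∈ 321∈ r
  reach (t3 ∷ r)      _ = three-to-ones 123∈ 132∈ 321∈ r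
  reach (t2 ∷ t1 ∷ r) v = absorb-two 123∈ 213∈ (size r) (reach (t1 ∷ r) v)
  reach (t2 ∷ t2 ∷ r) v = absorb-two 123∈ 213∈ (suc (size r)) (reach (t2 ∷ r) v)
  reach (t2 ∷ t3 ∷ r) v = absorb-two 123∈ 213∈ (suc (suc (size r))) (reach (t3 ∷ r) v)
  reach []            ()
  reach (t2 ∷ [])     ()
  counted : count V (comps n) ≡ T (n + 2) ∸ evenInd n
  counted = begin
    count V (comps n)                               ≡⟨ count-nonTwos _ (λ x → ∧-identityʳ _) n ⟩
    count (λ _ → true) (comps n) ∸ evenInd n        ≡⟨ cong (_∸ evenInd n) (count-all n) ⟩
    T (2 + n) ∸ evenInd n                           ≡⟨ cong (λ m → T m ∸ evenInd n) (+-comm 2 n) ⟩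
    T (n + 2) ∸ evenInd n                           ∎
    where open ≡-Reasoning

proposition4p1 : ∀ (n : ℕ) → 1 ≤ n →
    IsClassSize (p123 ∷ p132 ∷ []) n (F n)
    × IsClassSize (p123 ∷ p321 ∷ []) n (A2 n)
    × IsClassSize (p123 ∷ p132 ∷ p213 ∷ []) n (F (n + 1) ∸ evenInd n)
    × IsClassSize (p123 ∷ p132 ∷ p321 ∷ []) n (A4 n)
    × IsClassSize (p123 ∷ p132 ∷ p213 ∷ p321 ∷ []) n (T (n + 2) ∸ evenInd n)
proposition4p1 n 1≤n = case-i n 1≤n , case-ii n 1≤n , case-iii n 1≤n , case-iv n 1≤n , case-v n 1≤n
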